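{- For every finite semi-comparability graph $G$ with $\omega(G)=k$, we have $\chi(G)\leq\binom{k+1}{2}$.
   Context: An ordered graph $G_<$ (a graph with a total order $<$ on its vertex set) is a semi-comparability graph if there are no four vertices $a<b<c<d$ with $ab,bc,cd\in E(G)$ and $ac,bd\notin E(G)$. An unordered graph $G$ is a semi-comparability graph if some total order $<$ on $V(G)$ makes $G_<$ a semi-comparability graph. $\omega$ and $\chi$ denote clique number and chromatic number. -}

module Defs where

open import Level using (0ℓ)
open import Data.Nat using (ℕ; _≤_)
open import Data.Fin using (Fin)
open import Data.Product using (Σ; _×_)
open import Relation.Nullary using (¬_; Dec)
open import Relation.Binary.PropositionalEquality using (_≡_)
open import Relation.Binary.Structures using (IsStrictTotalOrder)
open import Function.Definitions using (Injective)

record Graph (n : ℕ) : Set₁ where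
  field
    Adj      : Fin n → Fin n → Set
    adj?     : ∀ u v → Dec (Adj u v)
    irrefl   : ∀ v → ¬ Adj v v
    sym      : ∀ {u v} → Adj u v → Adj v u
open Graph public

IsSemiComparabilityOrdered : ∀ {n} → Graph n → (Fin n → Fin n → Set) → Set
IsSemiComparabilityOrdered G _<_ =
  ∀ a b c d → a < b → b < c → c < d →
    Adj G a b → Adj G b c → Adj G c d →
    ¬ (¬ Adj G a c × ¬ Adj G b d)

IsSemiComparability : ∀ {n} → Graph n → Set₁
IsSemiComparability {n} G =
  Σ (Fin n → Fin n → Set) λ _<_ →
    IsStrictTotalOrder _≡_ _<_ × IsSemiComparabilityOrdered G _<_

IsClique : ∀ {n m} → Graph n → (Fin m → Fin n) → Set
IsClique G f = Injective _≡_ _≡_ f × (∀ i j → ¬ i ≡ j → Adj G (f i) (f j))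

CliqueNumber : ∀ {n} → Graph n → ℕ → Set
CliqueNumber {n} G k =
  Σ (Fin k → Fin n) (IsClique G) ×
  (∀ m (f : Fin m → Fin n) → IsClique G f → m ≤ k)

IsProperColouring : ∀ {n c} → Graph n → (Fin n → Fin c) → Set
IsProperColouring G col = ∀ u v → Adj G u v → ¬ col u ≡ col v

ChromaticAtMost : ∀ {n} → Graph n → ℕ → Set
ChromaticAtMost {n} G c = Σ (Fin n → Fin c) (IsProperColouring G)

module Submission where

-- Fix an order ≺ witnessing semi-comparability.  A *cone* at v of size m is a
-- clique of m vertices, each below v and adjacent to v; together with v it is
-- a clique of size m+1, so every cone has size < k.  Let
--   height v = the largest size of a cone at v,
--   level  v = the largest size of a cone at v inside the class of
--              vertices having the same height as v.
-- Semi-comparability makes edges inside one height class transitive along ≺: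
-- if x ≺ u ≺ v with xu, uv edges and height x = height u, then xv is an edge
-- (otherwise every vertex of a maximal cone at x is adjacent to u, and adding
-- x gives a larger cone at u).  Consequently, for an edge u ≺ v inside one
-- height class, a maximal same-class cone at u extends by u to one at v, so
-- level u < level v.  Hence v ↦ (height v, level v) is a proper colouring by
-- pairs b ≤ a < k, and there are exactly (k+1 choose 2) such pairs.

open import Defs
open import Data.Nat using (ℕ; zero; suc; _+_; _≤_; _<_; z≤n; s≤s)
open import Data.Nat.Properties
  using (≤-pred; ≤-trans; ≤∧≢⇒<; <⇒≤; <-irrefl; <-cmp; +-comm; +-cancelˡ-≡; +-mono-≤; +-monoʳ-<; m≤m+n; _≟_)
open import Data.Nat.Combinatorics using (_C_; nC1≡n; nCk+nC[k+1]≡[n+1]C[k+1])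
open import Data.Fin as Fin using (Fin; fromℕ<)
open import Data.Fin.Properties using (any?; fromℕ<-injective)
open import Data.Vec using (Vec; []; _∷_; lookup)
open import Data.Vec.Relation.Unary.All as All using (All; []; _∷_)
open import Data.Vec.Relation.Unary.All.Properties using (lookup⁺)
open import Data.Vec.Relation.Unary.AllPairs as AllPairs using (AllPairs; []; _∷_)
open import Data.Product using (Σ; ∃; _×_; _,_; proj₁; proj₂)
open import Data.Unit using (⊤; tt)
open import Data.Empty using (⊥-elim)
open import Relation.Nullary using (¬_; Dec; yes; no; _×-dec_)
open import Relation.Unary using (Decidable)
open import Relation.Binary.PropositionalEquality using (_≡_; _≢_; refl; cong; subst; module ≡-Reasoning)
  renaming (sym to ≡-sym; trans to ≡-trans)
open import Relation.Binary.Structures using (IsStrictTotalOrder)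
open import Relation.Binary.Definitions using (tri<; tri≈; tri>)

record Greatest (P : ℕ → Set) : Set where
  field
    value   : ℕ
    holds   : P value
    maximal : ∀ m → P m → m ≤ value

greatest : (P : ℕ → Set) → Decidable P → P 0 →
           ∀ b → (∀ m → P m → m ≤ b) → Greatest P
greatest P P? P0 zero bounded = record { value = 0 ; holds = P0 ; maximal = bounded }
greatest P P? P0 (suc b) bounded with P? (suc b)
... | yes Pb = record { value = suc b ; holds = Pb ; maximal = bounded }
... | no ¬Pb = greatest P P? P0 b below
  where
    below : ∀ m → P m → m ≤ b
    below m Pm = ≤-pred (≤∧≢⇒< (bounded m Pm) (λ m≡b → ¬Pb (subst P m≡b Pm)))

∃-vec? : ∀ {n} m {P : Vec (Fin n) m → Set} → Decidable P → Dec (∃ P)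
∃-vec? zero    P? with P? []
... | yes p = yes ([] , p)
... | no ¬p = no λ { ([] , p) → ¬p p }
∃-vec? (suc m) P? with any? (λ x → ∃-vec? m (λ w → P? (x ∷ w)))
... | yes (x , w , p) = yes (x ∷ w , p)
... | no ¬p = no λ { (x ∷ w , p) → ¬p (x , w , p) }

module _ {A : Set} {R : A → A → Set}
         (R-irrefl : ∀ x → ¬ R x x) (R-sym : ∀ {x y} → R x y → R y x) where

  allPairs-lookup : ∀ {m} {xs : Vec A m} → AllPairs R xs →
                    ∀ i j → i ≢ j → R (lookup xs i) (lookup xs j)
  allPairs-lookup (_ ∷ _)       Fin.zero    Fin.zero    i≢j = ⊥-elim (i≢j refl)
  allPairs-lookup (rs ∷ _)      Fin.zero    (Fin.suc j) _   = lookup⁺ rs j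
  allPairs-lookup (rs ∷ _)      (Fin.suc i) Fin.zero    _   = R-sym (lookup⁺ rs i)
  allPairs-lookup (_ ∷ related) (Fin.suc i) (Fin.suc j) i≢j =
    allPairs-lookup related i j (λ i≡j → i≢j (cong Fin.suc i≡j))

  allPairs-lookup-injective : ∀ {m} {xs : Vec A m} → AllPairs R xs →
                              ∀ {i j} → lookup xs i ≡ lookup xs j → i ≡ j
  allPairs-lookup-injective related {i} {j} xᵢ≡xⱼ with i Fin.≟ j
  ... | yes i≡j = i≡j
  ... | no  i≢j = ⊥-elim (R-irrefl _ (subst (R _) (≡-sym xᵢ≡xⱼ) (allPairs-lookup related i j i≢j)))

triangle : ℕ → ℕ
triangle zero    = 0
triangle (suc a) = triangle a + suc a

triangle≡C : ∀ k → triangle k ≡ suc k C 2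
triangle≡C zero    = refl
triangle≡C (suc k) = begin
  triangle k + suc k       ≡⟨ cong (_+ suc k) (triangle≡C k) ⟩
  suc k C 2 + suc k        ≡⟨ +-comm (suc k C 2) (suc k) ⟩
  suc k + suc k C 2        ≡⟨ cong (_+ suc k C 2) (≡-sym (nC1≡n (suc k))) ⟩
  suc k C 1 + suc k C 2    ≡⟨ nCk+nC[k+1]≡[n+1]C[k+1] (suc k) 1 ⟩
  suc (suc k) C 2          ∎
  where open ≡-Reasoning

triangle-mono : ∀ {a a'} → a ≤ a' → triangle a ≤ triangle a'
triangle-mono {zero}  _         = z≤n
triangle-mono {suc a} (s≤s a≤a') = +-mono-≤ (triangle-mono a≤a') (s≤s a≤a')

-- The pairs b ≤ a are enumerated row by row: row a occupies the codes
-- triangle a, …, triangle a + a.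
pairCode : ℕ → ℕ → ℕ
pairCode a b = triangle a + b

pairCode<triangle : ∀ {a b a'} → b ≤ a → a < a' → pairCode a b < triangle a'
pairCode<triangle {a} b≤a a<a' = ≤-trans (+-monoʳ-< (triangle a) (s≤s b≤a)) (triangle-mono a<a')

pairCode-injective : ∀ {a b a' b'} → b ≤ a → b' ≤ a' →
                     pairCode a b ≡ pairCode a' b' → a ≡ a' × b ≡ b'
pairCode-injective {a} {b} {a'} {b'} b≤a b'≤a' same with <-cmp a a'
... | tri< a<a' _ _ = ⊥-elim (<-irrefl refl (≤-trans (pairCode<triangle b≤a a<a')
                          (subst (triangle a' ≤_) (≡-sym same) (m≤m+n (triangle a') b'))))
... | tri> _ _ a'<a = ⊥-elim (<-irrefl refl (≤-trans (pairCode<triangle b'≤a' a'<a)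
                          (subst (triangle a ≤_) same (m≤m+n (triangle a) b))))
... | tri≈ _ refl _ = refl , +-cancelˡ-≡ (triangle a) b b' same

module Colouring {n k : ℕ} (G : Graph n) (_≺_ : Fin n → Fin n → Set)
  (order : IsStrictTotalOrder _≡_ _≺_) (semi : IsSemiComparabilityOrdered G _≺_)
  (cliqueBound : ∀ m (f : Fin m → Fin n) → IsClique G f → m ≤ k) where

  open IsStrictTotalOrder order using (compare) renaming (trans to ≺-trans; _<?_ to _≺?_)

  Below : (Fin n → Set) → Fin n → Fin n → Set
  Below R v y = y ≺ v × Adj G v y × R y

  Cone : (Fin n → Set) → Fin n → ℕ → Set
  Cone R v m = Σ (Vec (Fin n) m) λ w → All (Below R v) w × AllPairs (Adj G) w

  Cone? : ∀ {R} → Decidable R → ∀ v → Decidable (Cone R v)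
  Cone? R? v m = ∃-vec? m λ w →
    All.all? (λ y → (y ≺? v) ×-dec (adj? G v y ×-dec R? y)) w ×-dec AllPairs.allPairs? (adj? G) w

  -- A cone at v together with v itself is a clique, so cones have size < k.
  cone<k : ∀ {R v m} → Cone R v m → m < k
  cone<k {v = v} {m} (w , below , related) = cliqueBound (suc m) (lookup (v ∷ w))
    ( allPairs-lookup-injective (irrefl G) (sym G) vw
    , allPairs-lookup (irrefl G) (sym G) vw )
    where vw = All.map (λ y → proj₁ (proj₂ y)) below ∷ related

  Cone-mono : ∀ {R R' v m} → (∀ {y} → R y → R' y) → Cone R v m → Cone R' v m
  Cone-mono R⇒R' (w , below , related) =
    w , All.map (λ (y≺v , vy , Ry) → y≺v , vy , R⇒R' Ry) below , related

  extend : ∀ {R R' x u m} → Cone R x m → x ≺ u → Adj G x u → R' x →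
           (∀ {y} → Below R x y → Adj G u y × R' y) → Cone R' u (suc m)
  extend {x = x} (w , below , related) x≺u xu R'x lift =
    x ∷ w
    , (x≺u , sym G xu , R'x) ∷ All.map (λ b → ≺-trans (proj₁ b) x≺u , lift b) below
    , All.map (λ b → proj₁ (proj₂ b)) below ∷ related

  maxCone : ∀ {R} → Decidable R → ∀ v → Greatest (Cone R v)
  maxCone R? v = greatest _ (Cone? R? v) ([] , [] , []) k (λ _ cone → <⇒≤ (cone<k cone))

  heightCone : ∀ v → Greatest (Cone (λ _ → ⊤) v)
  heightCone = maxCone (λ _ → yes tt)

  height : Fin n → ℕ
  height v = Greatest.value (heightCone v)

  SameHeight : Fin n → Fin n → Set
  SameHeight v y = height y ≡ height v

  levelCone : ∀ v → Greatest (Cone (SameHeight v) v)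
  levelCone v = maxCone (λ y → height y ≟ height v) v

  level : Fin n → ℕ
  level v = Greatest.value (levelCone v)

  level≤height : ∀ v → level v ≤ height v
  level≤height v = Greatest.maximal (heightCone v) (level v)
                     (Cone-mono (λ _ → tt) (Greatest.holds (levelCone v)))

  height<k : ∀ v → height v < k
  height<k v = cone<k (Greatest.holds (heightCone v))

  height-transitive : ∀ {x u v} → x ≺ u → u ≺ v → Adj G x u → Adj G u v →
                      height x ≡ height u → Adj G x v
  height-transitive {x} {u} {v} x≺u u≺v xu uv same with adj? G x v
  ... | yes xv = xv
  ... | no ¬xv = ⊥-elim (<-irrefl same (Greatest.maximal (heightCone u) _ larger))
    where
      adjacent-to-u : ∀ {y} → Below (λ _ → ⊤) x y → Adj G u y × ⊤
      adjacent-to-u {y} (y≺x , xy , _) with adj? G y u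
      ... | yes yu = sym G yu , tt
      ... | no ¬yu = ⊥-elim (semi y x u v y≺x x≺u u≺v (sym G xy) xu uv (¬yu , ¬xv))

      larger : Cone (λ _ → ⊤) u (suc (height x))
      larger = extend (Greatest.holds (heightCone x)) x≺u xu tt adjacent-to-u

  level-increases : ∀ {u v} → u ≺ v → Adj G u v → height u ≡ height v → level u < level v
  level-increases {u} {v} u≺v uv same =
    Greatest.maximal (levelCone v) _ (extend (Greatest.holds (levelCone u)) u≺v uv same lift)
    where
      lift : ∀ {y} → Below (SameHeight u) u y → Adj G v y × SameHeight v y
      lift (y≺u , uy , y~u) = sym G (height-transitive y≺u u≺v (sym G uy) uv y~u) , ≡-trans y~u same

  colour : Fin n → Fin (suc k C 2)
  colour v = fromℕ< (subst (pairCode (height v) (level v) <_) (triangle≡C k)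
                       (pairCode<triangle (level≤height v) (height<k v)))

  colour-proper : IsProperColouring G colour
  colour-proper u v uv same-colour
    with pairCode-injective (level≤height u) (level≤height v)
           (fromℕ<-injective _ _ _ _ same-colour)
  ... | same-height , same-level with compare u v
  ...   | tri< u≺v _ _ = <-irrefl same-level (level-increases u≺v uv same-height)
  ...   | tri≈ _ refl _ = irrefl G u uv
  ...   | tri> _ _ v≺u = <-irrefl (≡-sym same-level) (level-increases v≺u (sym G uv) (≡-sym same-height))

lemma2 : ∀ (n k : ℕ) (G : Graph n) → IsSemiComparability G →
    CliqueNumber G k → ChromaticAtMost G (suc k C 2)
lemma2 n k G (_≺_ , order , semi) (_ , cliqueBound) = colour , colour-proper
  where open Colouring {n} {k} G _≺_ order semi cliqueBound
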